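{- Let $\epsilon>0$ and let $I^1$ be the rounded instance (see context). If $\mathrm{OPT}(I^1)\le1$ and $\overline m$ is a restricted outline of an optimal schedule of $I^1$, then there exists a schedule $\sigma^2$ of the instance $I^2(\overline m)$ such that $\sum_{j\in\sigma^2_i}p_{ij}\le c_i$ for every machine $i$ of $I^2(\overline m)$.
   Context: Robust scheduling on identical machines: $n$ jobs, $m$ identical machines, a positive integer $\Gamma$, each job $j$ has nominal processing time $\overline p_j\ge0$ and deviation $\hat p_j\ge0$. For a schedule $\sigma$ and machine $i$ with job set $\sigma_i$, $\Gamma(\sigma_i)$ denotes a set of $\Gamma$ jobs of $\sigma_i$ with largest deviation (ties arbitrary; all of $\sigma_i$ if $|\sigma_i|<\Gamma$), $C_\Gamma(\sigma)=\max_i\big(\sum_{j\in\sigma_i}\overline p_j+\sum_{j\in\Gamma(\sigma_i)}\hat p_j\big)$, $\mathrm{OPT}$ its minimum. Rounded instance $I^1$: same jobs, machines and nominal times; its deviations are $\hat p^1_j=0$ if $\hat p_j<\epsilon/\Gamma$, and otherwise the largest value of the form $\frac{\epsilon}{\Gamma}(1+\epsilon)^r$, $r\in\mathbb{Z}_{\ge0}$, not exceeding $\hat p_j$. Let $\Delta=\{0\}\cup\{\frac{\epsilon}{\Gamma}(1+\epsilon)^r: r\in\mathbb{Z}_{\ge0},\ \frac{\epsilon}{\Gamma}(1+\epsilon)^r\le\frac1\Gamma\}$. An outline of a schedule $\sigma$ of $I^1$ with $C_\Gamma(\sigma)\le1$ is a vector $t\in\Delta^m$ such that: if machine $i$ has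 at most $\Gamma$ jobs then $t_i=0$; otherwise every job on $i$ with $\hat p^1_j>t_i$ belongs to $\Gamma(\sigma_i)$ and no job on $i$ with $\hat p^1_j<t_i$ belongs to $\Gamma(\sigma_i)$. A restricted outline of $\sigma$ is the vector $\overline m=(\overline m_l)_{l\in\Delta}$ where, with $m_l=|\{i:t_i=l\}|$, $\overline m_l\in\{0,1,2,4,\dots,2^{\lfloor\log m\rfloor}\}$ satisfies $\overline m_l\le m_l<2\overline m_l$ ($\overline m_l=0$ if $m_l=0$). Let $\overline{\mathcal P}$ be the set of vectors $\overline m\in\{0,1,2,4,\dots,2^{\lfloor\log m\rfloor}\}^\Delta$ with $m/2\le\sum_l\overline m_l\le m$. For $\overline m\in\overline{\mathcal P}$ with $m'=\sum_l\overline m_l$, the instance $I^2(\overline m)$ (unrelated machines with capacities) is: for each $l\in\Delta$ a set $M_l$ of $\overline m_l$ original machines and a set $M'_l$ of $\overline m_l$ cloned machines, every machine $i\in M_l\cup M'_l$ having capacity $c_i=1-\Gamma l+\epsilon$; the regular jobs are the jobs of $I^1$ with $p_{ij}=\overline p_j+\hat p^1_j-l$ if $\hat p^1_j\ge l$ and $p_{ij}=\overline p_j$ otherwise, for $i\in M_l\cup M'_l$; in addition there are $2m'-m$ dummy jobs with $p_{ij}=\infty$ on original machines and $p_{ij}=c_i$ on cloned machines.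
   Formalization: The parameter ε, the nominal processing times and the deviations are rational, so the rounded deviations and the capacities and processing times of $I^2(\overline m)$ are rational as well. -}

module Defs where

open import Data.Nat as ℕ using (ℕ; zero; suc; NonZero)
open import Data.Fin using (Fin; toℕ)
open import Data.Fin.Properties using () renaming (_≟_ to _≟F_)
open import Data.Bool using (Bool; true; false; if_then_else_; _∧_)
open import Data.Maybe using (Maybe; nothing; just)
open import Data.Maybe.Properties using (≡-dec)
open import Data.Sum using (_⊎_; inj₁; inj₂)
open import Data.Product using (Σ; ∃; ∃-syntax; _×_; _,_; proj₁; proj₂)
open import Data.List using (List; []; _∷_; map; upTo)
open import Data.Integer using (+_)
open import Data.Rational using (ℚ; 0ℚ; 1ℚ; _+_; _-_; _*_; _≤_; _<_; _/_)
open import Data.Rational.Properties using (_≤?_)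
open import Relation.Nullary using (¬_)
open import Data.Unit using (⊤)
import Data.Fin
import Data.Bool
import Data.Rational as ℚ
open import Relation.Nullary.Decidable using (⌊_⌋)
open import Relation.Binary.PropositionalEquality using (_≡_)

sumFin : ∀ {k} → (Fin k → ℚ) → ℚ
sumFin {zero}  f = 0ℚ
sumFin {suc k} f = f Data.Fin.zero + sumFin (λ j → f (Data.Fin.suc j))

count : ∀ {k} → (Fin k → Bool) → ℕ
count {zero}  P = zero
count {suc k} P = (if P Data.Fin.zero then 1 else 0) ℕ.+ count (λ j → P (Data.Fin.suc j))

sumList : List ℕ → ℕ
sumList []       = 0
sumList (x ∷ xs) = x ℕ.+ sumList xs

_^Q_ : ℚ → ℕ → ℚ
x ^Q zero  = 1ℚ
x ^Q suc r = x * (x ^Q r)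

ℕtoℚ : ℕ → ℚ
ℕtoℚ k = (+ k) / 1

Schedule : ℕ → ℕ → Set
Schedule n m = Fin n → Fin m

onMachine : ∀ {n m} → Schedule n m → Fin m → Fin n → Bool
onMachine σ i j = ⌊ σ j ≟F i ⌋

-- T is a valid choice of Γ(σ_i) (a set of Γ jobs of σ_i with largest
-- deviation, all of σ_i if |σ_i| < Γ; ties arbitrary)
IsTopSet : ∀ {n m} → ℕ → (Fin n → ℚ) → Schedule n m → Fin m → (Fin n → Bool) → Set
IsTopSet {n} Γ dev σ i T =
  (∀ j → T j ≡ true → σ j ≡ i)
  × count T ≡ ℕ._⊓_ Γ (count (onMachine σ i))
  × (∀ j k → T j ≡ true → σ k ≡ i → T k ≡ false → dev k ≤ dev j)

load : ∀ {n m} → (Fin n → ℚ) → (Fin n → ℚ) → Schedule n m → Fin m → (Fin n → Bool) → ℚ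
load nom dev σ i T =
  sumFin (λ j → if onMachine σ i j then nom j else 0ℚ)
  + sumFin (λ j → if T j then dev j else 0ℚ)

CΓ≤ : ∀ {n m} → ℕ → (Fin n → ℚ) → (Fin n → ℚ) → Schedule n m → ℚ → Set
CΓ≤ Γ nom dev σ x = ∀ i T → IsTopSet Γ dev σ i T → load nom dev σ i T ≤ x

IsOptimal : ∀ {n m} → ℕ → (Fin n → ℚ) → (Fin n → ℚ) → Schedule n m → Set
IsOptimal {n} {m} Γ nom dev σ =
  ∀ (σ' : Schedule n m) (x : ℚ) → CΓ≤ Γ nom dev σ' x → CΓ≤ Γ nom dev σ x

εΓ : (ε : ℚ) (Γ : ℕ) → .{{NonZero Γ}} → ℚ
εΓ ε Γ = ε * ((+ 1) / Γ)

IsRounding : (ε : ℚ) (Γ : ℕ) → .{{NonZero Γ}} → ℚ → ℚ → Set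
IsRounding ε Γ d d¹ =
  (d < εΓ ε Γ × d¹ ≡ 0ℚ)
  ⊎ (∃[ r ] (d¹ ≡ εΓ ε Γ * ((1ℚ + ε) ^Q r)
             × d¹ ≤ d
             × d < εΓ ε Γ * ((1ℚ + ε) ^Q suc r)))

-- The set Δ.  An element of Δ is named by an index  l : Maybe ℕ :
--   nothing  denotes 0,   just r  denotes (ε/Γ)(1+ε)^r,
-- and  just r  is a legal index only if (ε/Γ)(1+ε)^r ≤ 1/Γ.

ΔIdx : Set
ΔIdx = Maybe ℕ

_≟Δ_ = ≡-dec ℕ._≟_

δ : (ε : ℚ) (Γ : ℕ) → .{{NonZero Γ}} → ΔIdx → ℚ
δ ε Γ nothing  = 0ℚ
δ ε Γ (just r) = εΓ ε Γ * ((1ℚ + ε) ^Q r)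

InΔ : (ε : ℚ) (Γ : ℕ) → .{{NonZero Γ}} → ΔIdx → Set
InΔ ε Γ nothing  = ⊤
InΔ ε Γ (just r) = δ ε Γ (just r) ≤ ((+ 1) / Γ)

-- a finite list of indices containing every legal index of Δ exactly once
-- together with some illegal ones: if ε = p/q then (ε/Γ)(1+ε)^r ≤ 1/Γ
-- forces r·ε² < 1, i.e. r < q².  (Illegal indices carry m̄_l = 0 below.)
ΔList : ℚ → List ΔIdx
ΔList ε = nothing ∷ map just (upTo (ℚ.denominatorℕ ε ℕ.* ℚ.denominatorℕ ε))

IsOutline : ∀ {n m} (ε : ℚ) (Γ : ℕ) → .{{NonZero Γ}} →
            (Fin n → ℚ) → Schedule n m → (Fin m → ΔIdx) → Set
IsOutline {n} {m} ε Γ dev¹ σ t =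
  ∀ (i : Fin m) →
    InΔ ε Γ (t i)
    × (count (onMachine σ i) ℕ.≤ Γ → t i ≡ nothing)
    × (Γ ℕ.< count (onMachine σ i) →
         ∃[ T ] (IsTopSet Γ dev¹ σ i T
                 × (∀ j → σ j ≡ i → δ ε Γ (t i) < dev¹ j → T j ≡ true)
                 × (∀ j → σ j ≡ i → dev¹ j < δ ε Γ (t i) → T j ≡ false)))

mCount : ∀ {m} → (Fin m → ΔIdx) → ΔIdx → ℕ
mCount t l = count (λ i → ⌊ t i ≟Δ l ⌋)

IsRoundedCount : ℕ → ℕ → Set
IsRoundedCount m k = k ≡ 0 ⊎ (∃[ e ] (2 ℕ.^ e ≡ k × 2 ℕ.^ e ℕ.≤ m))

IsRestrictedOutline : (m : ℕ) → (Fin m → ΔIdx) → (ΔIdx → ℕ) → Set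
IsRestrictedOutline m t m̄ =
  ∀ (l : ΔIdx) →
    IsRoundedCount m (m̄ l)
    × ((mCount t l ≡ 0 × m̄ l ≡ 0)
       ⊎ (m̄ l ℕ.≤ mCount t l × mCount t l ℕ.< 2 ℕ.* m̄ l))

m′ : ℚ → (ΔIdx → ℕ) → ℕ
m′ ε m̄ = sumList (map m̄ (ΔList ε))

-- machines: for each l, the k-th machine of M_l (orig = true)
-- or of M'_l (orig = false)
record Machine2 (m̄ : ΔIdx → ℕ) : Set where
  constructor mach
  field
    level : ΔIdx
    index : Fin (m̄ level)
    orig  : Bool
open Machine2 public

sameMachine : ∀ {m̄} → Machine2 m̄ → Machine2 m̄ → Bool
sameMachine (mach l k b) (mach l' k' b') =
  ⌊ l ≟Δ l' ⌋ ∧ ⌊ toℕ k ℕ.≟ toℕ k' ⌋ ∧ ⌊ b Data.Bool.≟ b' ⌋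

capacity : (ε : ℚ) (Γ : ℕ) → .{{NonZero Γ}} → ΔIdx → ℚ
capacity ε Γ l = 1ℚ - ℕtoℚ Γ * δ ε Γ l + ε

pReg : (ε : ℚ) (Γ : ℕ) → .{{NonZero Γ}} → ℚ → ℚ → ΔIdx → ℚ
pReg ε Γ nom dev¹ l =
  if ⌊ δ ε Γ l ≤? dev¹ ⌋ then nom + dev¹ - δ ε Γ l else nom

Job2 : ℕ → ℕ → ℚ → (ΔIdx → ℕ) → Set
Job2 n m ε m̄ = Fin n ⊎ Fin (2 ℕ.* m′ ε m̄ ℕ.∸ m)

-- σ² is a feasible schedule of I²(m̄): every dummy job is on a cloned
-- machine (its processing time on original machines is ∞), and the load
-- of every machine is at most its capacity
IsFeasible2 : ∀ {n m} (ε : ℚ) (Γ : ℕ) → .{{NonZero Γ}} →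
              (Fin n → ℚ) → (Fin n → ℚ) → (m̄ : ΔIdx → ℕ) →
              (Job2 n m ε m̄ → Machine2 m̄) → Set
IsFeasible2 {n} {m} ε Γ nom dev¹ m̄ σ² =
  (∀ d → orig (σ² (inj₂ d)) ≡ false)
  × (∀ (i : Machine2 m̄) →
       sumFin (λ j → if sameMachine (σ² (inj₁ j)) i
                        then pReg ε Γ (nom j) (dev¹ j) (level i) else 0ℚ)
       + sumFin (λ d → if sameMachine (σ² (inj₂ d)) i
                        then capacity ε Γ (level i) else 0ℚ)
       ≤ capacity ε Γ (level i))

module Submission where

-- Rank the machines i with tᵢ = l (the machines of level l) among themselves and let the
-- machine of rank r become position r of level l in I²(m̄): positions below m̄_l are original
-- machines, the others clones, and every rank has a position since m_l < 2m̄_l.  There a job of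
-- σᵢ costs p̄ + p̂¹ − δ_l if it is in Γ(σᵢ) and p̄ otherwise (by the outline property; jobs with
-- p̂¹ = δ_l cost p̄ either way), and |Γ(σᵢ)| = Γ unless δ_l = 0, so the load C_Γ ≤ 1 of σᵢ
-- becomes at most 1 − Γδ_l.  The positions m_l, …, 2m̄_l − 1 left free are clones as
-- m̄_l ≤ m_l, and there are Σ_l (2m̄_l − m_l) ≥ 2m′ − m of them: one for each dummy job, which
-- fills its clone exactly.

open import Defs
open import Algebra.Bundles using (CommutativeMonoid)
import Algebra.Properties.CommutativeSemigroup as CommutativeSemigroup
open import Data.Bool using (Bool; true; false; if_then_else_; _∧_; _∨_)
open import Data.Bool.ListAction using (any)
import Data.Bool.Properties as Bool
open import Data.Fin as Fin using (Fin; zero; suc; toℕ; _↑ˡ_; _↑ʳ_; splitAt)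
import Data.Fin.Properties as Fin
import Data.Integer as ℤ
import Data.Integer.Properties as ℤ
open import Data.List using (List; []; _∷_; map)
open import Data.List.Membership.Propositional using (_∈_)
open import Data.List.Relation.Unary.All as All using (All; []; _∷_)
import Data.List.Relation.Unary.All.Properties as All
open import Data.List.Relation.Unary.AllPairs using ([]; _∷_)
open import Data.List.Relation.Unary.Any using (here; there)
open import Data.List.Relation.Unary.Unique.Propositional using (Unique)
import Data.List.Relation.Unary.Unique.Propositional.Properties as Unique
open import Data.Maybe using (nothing; just)
open import Data.Nat as ℕ using (ℕ; NonZero; zero; suc; z≤n; s≤s)
import Data.Nat.Properties as ℕ
open import Data.Product using (∃-syntax; _×_; _,_; proj₁; proj₂)
import Data.Product.Properties as Product
open import Data.Rational using (ℚ; 0ℚ; 1ℚ; _≤_; _<_; _+_; _-_; _*_; _/_; -_; toℚᵘ; nonNegative)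
import Data.Rational.Properties as ℚ
open import Data.Rational.Solver using (module +-*-Solver)
import Data.Rational.Unnormalised as ℚᵘ
import Data.Rational.Unnormalised.Properties as ℚᵘ
open import Data.Sum using (_⊎_; inj₁; inj₂)
open import Function using (_∘_; Injective)
open import Relation.Binary.Definitions using (DecidableEquality; tri<; tri≈; tri>)
open import Relation.Binary.PropositionalEquality
open import Relation.Nullary using (¬_; Dec; yes; no; contradiction)
open import Relation.Nullary.Decidable using (⌊_⌋; map′; isYes≗does; dec-true; dec-false)

private
  module ℕ+ = CommutativeSemigroup ℕ.+-commutativeSemigroup
  module ℚ+ = CommutativeSemigroup (CommutativeMonoid.commutativeSemigroup ℚ.+-0-commutativeMonoid)

ℕtoℚ-suc : ∀ k → ℕtoℚ (suc k) ≡ 1ℚ + ℕtoℚ k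
ℕtoℚ-suc k = ℚ.toℚᵘ-injective (begin
  toℚᵘ (ℕtoℚ (suc k))              ≈⟨ ℚ.toℚᵘ-fromℚᵘ (ℚᵘ.mkℚᵘ (ℤ.+ suc k) 0) ⟩
  ℚᵘ.mkℚᵘ (ℤ.+ suc k) 0            ≈⟨ ℚᵘ.*≡* (cong (λ z → (ℤ.+ 1 ℤ.+ z) ℤ.* ℤ.+ 1)
                                                     (sym (ℤ.*-identityʳ (ℤ.+ k)))) ⟩
  ℚᵘ.1ℚᵘ ℚᵘ.+ ℚᵘ.mkℚᵘ (ℤ.+ k) 0   ≈⟨ ℚᵘ.+-congʳ ℚᵘ.1ℚᵘ (ℚ.toℚᵘ-fromℚᵘ (ℚᵘ.mkℚᵘ (ℤ.+ k) 0)) ⟨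
  toℚᵘ 1ℚ ℚᵘ.+ toℚᵘ (ℕtoℚ k)       ≈⟨ ℚ.toℚᵘ-homo-+ 1ℚ (ℕtoℚ k) ⟨
  toℚᵘ (1ℚ + ℕtoℚ k)               ∎)
  where open ℚᵘ.≃-Reasoning

ℕtoℚ[n]*1/n≡1 : ∀ n .{{_ : NonZero n}} → ℕtoℚ n * (ℤ.+ 1 / n) ≡ 1ℚ
ℕtoℚ[n]*1/n≡1 n@(suc g) = ℚ.toℚᵘ-injective (begin
  toℚᵘ (ℕtoℚ n * (ℤ.+ 1 / n))               ≈⟨ ℚ.toℚᵘ-homo-* (ℕtoℚ n) (ℤ.+ 1 / n) ⟩
  toℚᵘ (ℕtoℚ n) ℚᵘ.* toℚᵘ (ℤ.+ 1 / n)       ≈⟨ ℚᵘ.*-cong (ℚ.toℚᵘ-fromℚᵘ (ℚᵘ.mkℚᵘ (ℤ.+ n) 0))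
                                                          (ℚ.toℚᵘ-fromℚᵘ (ℚᵘ.mkℚᵘ (ℤ.+ 1) g)) ⟩
  ℚᵘ.mkℚᵘ (ℤ.+ n) 0 ℚᵘ.* ℚᵘ.mkℚᵘ (ℤ.+ 1) g  ≈⟨ ℚᵘ.*≡* (trans (ℤ.*-identityʳ _)
                                                  (trans (ℤ.*-identityʳ (ℤ.+ n))
                                                  (sym (trans (ℤ.*-identityˡ _)
                                                              (cong ℤ.+_ (ℕ.*-identityˡ n)))))) ⟩
  ℚᵘ.1ℚᵘ                                    ∎)
  where open ℚᵘ.≃-Reasoning

*-nonNeg : ∀ {p q} → 0ℚ ≤ p → 0ℚ ≤ q → 0ℚ ≤ p * q
*-nonNeg {p} 0≤p 0≤q = subst (_≤ p * _) (ℚ.*-zeroʳ p) (ℚ.*-monoˡ-≤-nonNeg p {{nonNegative 0≤p}} 0≤q)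

^Q-nonNeg : ∀ {x} → 0ℚ ≤ x → ∀ r → 0ℚ ≤ x ^Q r
^Q-nonNeg 0≤x zero    = ℚ.nonNegative⁻¹ 1ℚ
^Q-nonNeg 0≤x (suc r) = *-nonNeg 0≤x (^Q-nonNeg 0≤x r)

1/n-nonNeg : ∀ n .{{_ : NonZero n}} → 0ℚ ≤ ℤ.+ 1 / n
1/n-nonNeg n = ℚ.nonNegative⁻¹ _ {{ℚ.normalize-nonNeg 1 n}}

p≤p+q : ∀ {p q} → 0ℚ ≤ q → p ≤ p + q
p≤p+q {p} 0≤q = subst (_≤ p + _) (ℚ.+-identityʳ p) (ℚ.+-monoʳ-≤ p 0≤q)

isYes-true : ∀ {P : Set} (d : Dec P) → P → ⌊ d ⌋ ≡ true
isYes-true d p = trans (isYes≗does d) (dec-true d p)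

isYes-false : ∀ {P : Set} (d : Dec P) → ¬ P → ⌊ d ⌋ ≡ false
isYes-false d ¬p = trans (isYes≗does d) (dec-false d ¬p)

isYes-sound : ∀ {P : Set} (d : Dec P) → ⌊ d ⌋ ≡ true → P
isYes-sound (yes p) _ = p

count-≤ : ∀ {k} (P : Fin k → Bool) → count P ℕ.≤ k
count-≤ {zero}  P = z≤n
count-≤ {suc k} P with P zero
... | true  = s≤s (count-≤ (P ∘ suc))
... | false = ℕ.m≤n⇒m≤1+n (count-≤ (P ∘ suc))

count-mono : ∀ {k} (P Q : Fin k → Bool) → (∀ j → P j ≡ true → Q j ≡ true) →
             count P ℕ.≤ count Q
count-mono {zero}  P Q P⊆Q = z≤n
count-mono {suc k} P Q P⊆Q with P zero in p₀ | Q zero in q₀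
... | true  | true  = s≤s (count-mono (P ∘ suc) (Q ∘ suc) (P⊆Q ∘ suc))
... | true  | false with () ← trans (sym (P⊆Q zero p₀)) q₀
... | false | true  = ℕ.m≤n⇒m≤1+n (count-mono (P ∘ suc) (Q ∘ suc) (P⊆Q ∘ suc))
... | false | false = count-mono (P ∘ suc) (Q ∘ suc) (P⊆Q ∘ suc)

count-mono-< : ∀ {k} (P Q : Fin k → Bool) → (∀ j → P j ≡ true → Q j ≡ true) →
               ∀ j → P j ≡ false → Q j ≡ true → count P ℕ.< count Q
count-mono-< {suc k} P Q P⊆Q zero p₀ q₀ rewrite p₀ | q₀ =
  s≤s (count-mono (P ∘ suc) (Q ∘ suc) (P⊆Q ∘ suc))
count-mono-< {suc k} P Q P⊆Q (suc j) pj qj with P zero in p₀ | Q zero in q₀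
... | true  | true  = s≤s (count-mono-< (P ∘ suc) (Q ∘ suc) (P⊆Q ∘ suc) j pj qj)
... | true  | false with () ← trans (sym (P⊆Q zero p₀)) q₀
... | false | true  = ℕ.m≤n⇒m≤1+n (count-mono-< (P ∘ suc) (Q ∘ suc) (P⊆Q ∘ suc) j pj qj)
... | false | false = count-mono-< (P ∘ suc) (Q ∘ suc) (P⊆Q ∘ suc) j pj qj

count-pos : ∀ {k} (P : Fin k → Bool) → 0 ℕ.< count P → ∃[ j ] P j ≡ true
count-pos {suc k} P 0<c with P zero in p₀
... | true  = zero , p₀
... | false with j , pj ← count-pos (P ∘ suc) 0<c = suc j , pj

count-∨ : ∀ {k} (P Q : Fin k → Bool) → (∀ j → P j ≡ true → Q j ≡ false) →
          count (λ j → P j ∨ Q j) ≡ count P ℕ.+ count Q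
count-∨ {zero}  P Q disj = refl
count-∨ {suc k} P Q disj with P zero in p₀ | Q zero in q₀
... | true  | true  with () ← trans (sym q₀) (disj zero p₀)
... | true  | false = cong suc (count-∨ (P ∘ suc) (Q ∘ suc) (disj ∘ suc))
... | false | true  = trans (cong suc (count-∨ (P ∘ suc) (Q ∘ suc) (disj ∘ suc)))
                            (sym (ℕ.+-suc _ _))
... | false | false = count-∨ (P ∘ suc) (Q ∘ suc) (disj ∘ suc)

sumFin-cong : ∀ {k} {f g : Fin k → ℚ} → (∀ j → f j ≡ g j) → sumFin f ≡ sumFin g
sumFin-cong {zero}  f≗g = refl
sumFin-cong {suc k} f≗g = cong₂ _+_ (f≗g zero) (sumFin-cong (f≗g ∘ suc))

sumFin-zero : ∀ {k} {f : Fin k → ℚ} → (∀ j → f j ≡ 0ℚ) → sumFin f ≡ 0ℚ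
sumFin-zero {zero}  f≗0 = refl
sumFin-zero {suc k} f≗0 = cong₂ _+_ (f≗0 zero) (sumFin-zero (f≗0 ∘ suc))

sumFin-+ : ∀ {k} (f g : Fin k → ℚ) → sumFin (λ j → f j + g j) ≡ sumFin f + sumFin g
sumFin-+ {zero}  f g = refl
sumFin-+ {suc k} f g = begin
  (f zero + g zero) + sumFin (λ j → f (suc j) + g (suc j))
    ≡⟨ cong ((f zero + g zero) +_) (sumFin-+ (f ∘ suc) (g ∘ suc)) ⟩
  (f zero + g zero) + (sumFin (f ∘ suc) + sumFin (g ∘ suc))
    ≡⟨ ℚ+.interchange (f zero) (g zero) (sumFin (f ∘ suc)) (sumFin (g ∘ suc)) ⟩
  (f zero + sumFin (f ∘ suc)) + (g zero + sumFin (g ∘ suc)) ∎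
  where open ≡-Reasoning

sumFin-if-minus : ∀ {k} (T : Fin k → Bool) (a : Fin k → ℚ) (c : ℚ) →
  sumFin (λ j → if T j then a j - c else 0ℚ)
    ≡ sumFin (λ j → if T j then a j else 0ℚ) - c * ℕtoℚ (count T)
sumFin-if-minus {zero}  T a c = solve 1 (λ c → con 0ℚ := con 0ℚ :- c :* con 0ℚ) refl c
  where open +-*-Solver
sumFin-if-minus {suc k} T a c with T zero
... | true  = begin
  (a zero - c) + sumFin (λ j → if T (suc j) then a (suc j) - c else 0ℚ)
    ≡⟨ cong ((a zero - c) +_) (sumFin-if-minus (T ∘ suc) (a ∘ suc) c) ⟩
  (a zero - c) + (S - c * ℕtoℚ n)
    ≡⟨ solve 4 (λ x s c n → (x :- c) :+ (s :- c :* n) := (x :+ s) :- c :* (con 1ℚ :+ n)) refl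
         (a zero) S c (ℕtoℚ n) ⟩
  (a zero + S) - c * (1ℚ + ℕtoℚ n)
    ≡⟨ cong (λ z → (a zero + S) - c * z) (ℕtoℚ-suc n) ⟨
  (a zero + S) - c * ℕtoℚ (suc n) ∎
  where
  open ≡-Reasoning
  open +-*-Solver
  S = sumFin (λ j → if T (suc j) then a (suc j) else 0ℚ)
  n = count (T ∘ suc)
... | false = trans (cong (0ℚ +_) (sumFin-if-minus (T ∘ suc) (a ∘ suc) c))
                (solve 3 (λ s c n → con 0ℚ :+ (s :- c :* n) := (con 0ℚ :+ s) :- c :* n) refl
                   (sumFin (λ j → if T (suc j) then a (suc j) else 0ℚ)) c (ℕtoℚ (count (T ∘ suc))))
  where open +-*-Solver

sumFin-atMostOne-≤ : ∀ {k} (P : Fin k → Bool) {c : ℚ} → 0ℚ ≤ c →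
                     (∀ j j′ → P j ≡ true → P j′ ≡ true → j ≡ j′) →
                     sumFin (λ j → if P j then c else 0ℚ) ≤ c
sumFin-atMostOne-≤ {zero}  P 0≤c unique = 0≤c
sumFin-atMostOne-≤ {suc k} P {c} 0≤c unique with P zero in p₀
... | true  = ℚ.≤-reflexive (trans (cong (c +_) (sumFin-zero rest≗0)) (ℚ.+-identityʳ c))
  where
  rest≗0 : ∀ j → (if P (suc j) then c else 0ℚ) ≡ 0ℚ
  rest≗0 j with P (suc j) in pj
  ... | true with () ← unique zero (suc j) p₀ pj
  ... | false = refl
... | false = ℚ.≤-trans (ℚ.≤-reflexive (ℚ.+-identityˡ _))
                (sumFin-atMostOne-≤ (P ∘ suc) 0≤c (λ j j′ pj pj′ → Fin.suc-injective (unique _ _ pj pj′)))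

module _ {A : Set} where

  sumList-map-* : ∀ c (f : A → ℕ) L → sumList (map (λ x → c ℕ.* f x) L) ≡ c ℕ.* sumList (map f L)
  sumList-map-* c f []      = sym (ℕ.*-zeroʳ c)
  sumList-map-* c f (x ∷ L) = trans (cong (c ℕ.* f x ℕ.+_) (sumList-map-* c f L))
                                    (sym (ℕ.*-distribˡ-+ c (f x) (sumList (map f L))))

  sumList-map-≤ : ∀ {f g h : A → ℕ} → (∀ x → f x ℕ.≤ g x ℕ.+ h x) → ∀ L →
                  sumList (map f L) ℕ.≤ sumList (map g L) ℕ.+ sumList (map h L)
  sumList-map-≤ f≤g+h []      = z≤n
  sumList-map-≤ {f} {g} {h} f≤g+h (x ∷ L) = ℕ.≤-trans
    (ℕ.+-mono-≤ (f≤g+h x) (sumList-map-≤ f≤g+h L))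
    (ℕ.≤-reflexive (ℕ+.interchange (g x) (h x) (sumList (map g L)) (sumList (map h L))))

module Fibres {A : Set} (_≟_ : DecidableEquality A) {k : ℕ} (t : Fin k → A) where

  size : A → ℕ
  size a = count (λ i → ⌊ t i ≟ a ⌋)

  earlier : Fin k → Fin k → Bool
  earlier i j = ⌊ j Fin.<? i ⌋ ∧ ⌊ t j ≟ t i ⌋

  rank : Fin k → ℕ
  rank i = count (earlier i)

  earlier⁻ : ∀ {i j} → earlier i j ≡ true → j Fin.< i × t j ≡ t i
  earlier⁻ {i} {j} e with j Fin.<? i | t j ≟ t i
  ... | yes j<i | yes tj≡ti = j<i , tj≡ti

  earlier⁺ : ∀ {i j} → j Fin.< i → t j ≡ t i → earlier i j ≡ true
  earlier⁺ {i} {j} j<i tj≡ti = cong₂ _∧_ (isYes-true (j Fin.<? i) j<i) (isYes-true (t j ≟ t i) tj≡ti)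

  earlier-irrefl : ∀ i → earlier i i ≡ false
  earlier-irrefl i = cong (_∧ ⌊ t i ≟ t i ⌋) (isYes-false (i Fin.<? i) (Fin.<-irrefl refl))

  rank<size : ∀ i → rank i ℕ.< size (t i)
  rank<size i = count-mono-< (earlier i) (λ j → ⌊ t j ≟ t i ⌋)
    (λ j e → isYes-true (t j ≟ t i) (proj₂ (earlier⁻ e)))
    i (earlier-irrefl i) (isYes-true (t i ≟ t i) refl)

  rank-mono-< : ∀ {i i′} → i Fin.< i′ → t i ≡ t i′ → rank i ℕ.< rank i′
  rank-mono-< {i} {i′} i<i′ ti≡ti′ = count-mono-< (earlier i) (earlier i′)
    (λ j e → let j<i , tj≡ti = earlier⁻ e in earlier⁺ (Fin.<-trans j<i i<i′) (trans tj≡ti ti≡ti′))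
    i (earlier-irrefl i) (earlier⁺ i<i′ ti≡ti′)

  rank-injective : ∀ {i i′} → t i ≡ t i′ → rank i ≡ rank i′ → i ≡ i′
  rank-injective {i} {i′} ti≡ti′ ri≡ri′ with Fin.<-cmp i i′
  ... | tri< i<i′ _ _ = contradiction ri≡ri′ (ℕ.<⇒≢ (rank-mono-< i<i′ ti≡ti′))
  ... | tri≈ _ i≡i′ _ = i≡i′
  ... | tri> _ _ i′<i = contradiction (sym ri≡ri′) (ℕ.<⇒≢ (rank-mono-< i′<i (sym ti≡ti′)))

  size-inhabited : ∀ {a} → 0 ℕ.< size a → ∃[ i ] t i ≡ a
  size-inhabited {a} 0<size with i , e ← count-pos (λ i → ⌊ t i ≟ a ⌋) 0<size = i , isYes-sound (t i ≟ a) e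

  sumList-size-≤ : ∀ {L} → Unique L → sumList (map size L) ℕ.≤ k
  sumList-size-≤ u = ℕ.≤-trans (≤-count u) (count-≤ _)
    where
    any-≟-false : ∀ {a L} → All (a ≢_) L → any (λ b → ⌊ a ≟ b ⌋) L ≡ false
    any-≟-false []                 = refl
    any-≟-false {a} (a≢b ∷ a∉L) = cong₂ _∨_ (isYes-false (a ≟ _) a≢b) (any-≟-false a∉L)

    ≤-count : ∀ {L} → Unique L → sumList (map size L) ℕ.≤ count (λ i → any (λ b → ⌊ t i ≟ b ⌋) L)
    ≤-count {[]}    []          = z≤n
    ≤-count {x ∷ L} (x∉L ∷ u) =
      ℕ.≤-trans (ℕ.+-monoʳ-≤ (size x) (≤-count u)) (ℕ.≤-reflexive (sym (count-∨ _ _ disjoint)))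
      where
      disjoint : ∀ i → ⌊ t i ≟ x ⌋ ≡ true → any (λ b → ⌊ t i ≟ b ⌋) L ≡ false
      disjoint i tᵢ≡x rewrite isYes-sound (t i ≟ x) tᵢ≡x = any-≟-false x∉L

module _ {A : Set} (f : A → ℕ) where

  pick : (L : List A) → Fin (sumList (map f L)) → A × ℕ
  pick (x ∷ L) d with splitAt (f x) d
  ... | inj₁ k  = x , toℕ k
  ... | inj₂ d′ = pick L d′

  pick-< : ∀ L d → proj₂ (pick L d) ℕ.< f (proj₁ (pick L d))
  pick-< (x ∷ L) d with splitAt (f x) d
  ... | inj₁ k  = Fin.toℕ<n k
  ... | inj₂ d′ = pick-< L d′

  pick-∈ : ∀ L d → proj₁ (pick L d) ∈ L
  pick-∈ (x ∷ L) d with splitAt (f x) d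
  ... | inj₁ k  = here refl
  ... | inj₂ d′ = there (pick-∈ L d′)

  pick-injective : ∀ {L} → Unique L → ∀ {d d′} → pick L d ≡ pick L d′ → d ≡ d′
  pick-injective {x ∷ L} (x∉L ∷ u) {d} {d′} e
    with splitAt (f x) d in eq | splitAt (f x) d′ in eq′
  ... | inj₁ k | inj₁ k′ = begin
    d               ≡⟨ Fin.splitAt⁻¹-↑ˡ eq ⟨
    k ↑ˡ _          ≡⟨ cong (_↑ˡ _) (Fin.toℕ-injective (Product.,-injectiveʳ e)) ⟩
    k′ ↑ˡ _         ≡⟨ Fin.splitAt⁻¹-↑ˡ eq′ ⟩
    d′              ∎
    where open ≡-Reasoning
  ... | inj₂ r | inj₂ r′ = begin
    d               ≡⟨ Fin.splitAt⁻¹-↑ʳ eq ⟨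
    f x ↑ʳ r        ≡⟨ cong (f x ↑ʳ_) (pick-injective u e) ⟩
    f x ↑ʳ r′       ≡⟨ Fin.splitAt⁻¹-↑ʳ eq′ ⟩
    d′              ∎
    where open ≡-Reasoning
  ... | inj₁ k | inj₂ r′ = contradiction (cong proj₁ e) (All.lookup x∉L (pick-∈ L r′))
  ... | inj₂ r | inj₁ k′ = contradiction (cong proj₁ (sym e)) (All.lookup x∉L (pick-∈ L r))

module _ {Γ : ℕ} .{{_ : NonZero Γ}} {ε : ℚ} (0≤ε : 0ℚ ≤ ε) where

  δ-nonNeg : ∀ l → 0ℚ ≤ δ ε Γ l
  δ-nonNeg nothing  = ℚ.≤-refl
  δ-nonNeg (just r) =
    *-nonNeg (*-nonNeg 0≤ε (1/n-nonNeg Γ)) (^Q-nonNeg (ℚ.+-mono-≤ (ℚ.nonNegative⁻¹ 1ℚ) 0≤ε) r)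

  rounding-nonNeg : ∀ {d d¹} → IsRounding ε Γ d d¹ → 0ℚ ≤ d¹
  rounding-nonNeg (inj₁ (_ , refl))     = ℚ.≤-refl
  rounding-nonNeg (inj₂ (r , refl , _)) = δ-nonNeg (just r)

  capacity-nonNeg : ∀ {l} → InΔ ε Γ l → 0ℚ ≤ capacity ε Γ l
  capacity-nonNeg {l} l∈Δ = begin
    0ℚ                                   ≡⟨ ℚ.+-inverseʳ (ℕtoℚ Γ * δ ε Γ l) ⟨
    ℕtoℚ Γ * δ ε Γ l - ℕtoℚ Γ * δ ε Γ l  ≤⟨ ℚ.+-monoˡ-≤ (- (ℕtoℚ Γ * δ ε Γ l)) Γδ≤1 ⟩
    1ℚ - ℕtoℚ Γ * δ ε Γ l                ≤⟨ p≤p+q 0≤ε ⟩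
    capacity ε Γ l                       ∎
    where
    open ℚ.≤-Reasoning
    δ≤1/Γ : ∀ l → InΔ ε Γ l → δ ε Γ l ≤ ℤ.+ 1 / Γ
    δ≤1/Γ nothing  _    = 1/n-nonNeg Γ
    δ≤1/Γ (just r) l∈Δ = l∈Δ
    Γδ≤1 : ℕtoℚ Γ * δ ε Γ l ≤ 1ℚ
    Γδ≤1 = begin
      ℕtoℚ Γ * δ ε Γ l      ≤⟨ ℚ.*-monoˡ-≤-nonNeg (ℕtoℚ Γ) {{ℚ.normalize-nonNeg Γ 1}} (δ≤1/Γ l l∈Δ) ⟩
      ℕtoℚ Γ * (ℤ.+ 1 / Γ)  ≡⟨ ℕtoℚ[n]*1/n≡1 Γ ⟩
      1ℚ                    ∎

IsThresholdSet : ∀ {n m} → (Fin n → ℚ) → Schedule n m → Fin m → ℚ → (Fin n → Bool) → Set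
IsThresholdSet dev σ i θ T =
  (∀ j → T j ≡ true → σ j ≡ i)
  × (∀ j → σ j ≡ i → θ < dev j → T j ≡ true)
  × (∀ j → σ j ≡ i → dev j < θ → T j ≡ false)

levelLoad : ∀ {n m} (ε : ℚ) (Γ : ℕ) → .{{NonZero Γ}} →
            (Fin n → ℚ) → (Fin n → ℚ) → Schedule n m → Fin m → ΔIdx → ℚ
levelLoad ε Γ nom dev¹ σ i l = sumFin (λ j → if onMachine σ i j then pReg ε Γ (nom j) (dev¹ j) l else 0ℚ)

module _ {n m Γ : ℕ} .{{_ : NonZero Γ}} (ε : ℚ) (nom dev¹ : Fin n → ℚ) (σ : Schedule n m) where

  pReg-split : ∀ {i l T} → IsThresholdSet dev¹ σ i (δ ε Γ l) T → ∀ j →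
    (if onMachine σ i j then pReg ε Γ (nom j) (dev¹ j) l else 0ℚ)
      ≡ (if onMachine σ i j then nom j else 0ℚ) + (if T j then dev¹ j - δ ε Γ l else 0ℚ)
  pReg-split {i} {l} {T} (T⊆σᵢ , above , below) j with σ j Fin.≟ i
  ... | no σj≢i with T j in Tj
  ...   | true  = contradiction (T⊆σᵢ j Tj) σj≢i
  ...   | false = refl
  pReg-split {i} {l} {T} (T⊆σᵢ , above , below) j | yes σj≡i with δ ε Γ l ℚ.≤? dev¹ j
  ... | yes δ≤dev with T j in Tj
  ...   | true  = ℚ.+-assoc (nom j) (dev¹ j) (- δ ε Γ l)
  ...   | false = begin
    nom j + dev¹ j - δ ε Γ l    ≡⟨ cong (λ x → nom j + x - δ ε Γ l) dev≡δ ⟩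
    nom j + δ ε Γ l - δ ε Γ l   ≡⟨ solve 2 (λ a b → a :+ b :- b := a :+ con 0ℚ) refl (nom j) (δ ε Γ l) ⟩
    nom j + 0ℚ                  ∎
    where
    open ≡-Reasoning
    open +-*-Solver
    dev≡δ : dev¹ j ≡ δ ε Γ l
    dev≡δ = ℚ.≤-antisym (ℚ.≮⇒≥ λ δ<dev → contradiction (trans (sym Tj) (above j σj≡i δ<dev)) λ ()) δ≤dev
  pReg-split {i} {l} {T} (T⊆σᵢ , above , below) j | yes σj≡i | no δ≰dev with T j in Tj
  ... | true  = contradiction (trans (sym Tj) (below j σj≡i (ℚ.≰⇒> δ≰dev))) λ ()
  ... | false = sym (ℚ.+-identityʳ (nom j))

  levelLoad-threshold : ∀ {i l T} → IsThresholdSet dev¹ σ i (δ ε Γ l) T →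
    levelLoad ε Γ nom dev¹ σ i l ≡ load nom dev¹ σ i T - δ ε Γ l * ℕtoℚ (count T)
  levelLoad-threshold {i} {l} {T} threshold = begin
    levelLoad ε Γ nom dev¹ σ i l
      ≡⟨ sumFin-cong (pReg-split {l = l} threshold) ⟩
    sumFin (λ j → nomᵢ j + (if T j then dev¹ j - δ ε Γ l else 0ℚ))
      ≡⟨ sumFin-+ nomᵢ _ ⟩
    sumFin nomᵢ + sumFin (λ j → if T j then dev¹ j - δ ε Γ l else 0ℚ)
      ≡⟨ cong (sumFin nomᵢ +_) (sumFin-if-minus T dev¹ (δ ε Γ l)) ⟩
    sumFin nomᵢ + (sumFin devᵢ - δ ε Γ l * ℕtoℚ (count T))
      ≡⟨ ℚ.+-assoc (sumFin nomᵢ) (sumFin devᵢ) (- (δ ε Γ l * ℕtoℚ (count T))) ⟨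
    load nom dev¹ σ i T - δ ε Γ l * ℕtoℚ (count T) ∎
    where
    open ≡-Reasoning
    nomᵢ devᵢ : Fin n → ℚ
    nomᵢ j = if onMachine σ i j then nom j else 0ℚ
    devᵢ j = if T j then dev¹ j else 0ℚ

  outline⇒thresholdSet : (∀ j → 0ℚ ≤ dev¹ j) → ∀ {t} → IsOutline ε Γ dev¹ σ t → ∀ i →
    ∃[ T ] IsTopSet Γ dev¹ σ i T × IsThresholdSet dev¹ σ i (δ ε Γ (t i)) T
           × (count T ≡ Γ ⊎ t i ≡ nothing)
  outline⇒thresholdSet dev¹≥0 {t} outline i with Γ ℕ.<? count (onMachine σ i)
  ... | yes Γ<|σᵢ| with T , top , above , below ← proj₂ (proj₂ (outline i)) Γ<|σᵢ| =
    T , top , (proj₁ top , above , below) ,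
    inj₁ (trans (proj₁ (proj₂ top)) (ℕ.m≤n⇒m⊓n≡m (ℕ.<⇒≤ Γ<|σᵢ|)))
  ... | no Γ≮|σᵢ| = onMachine σ i , top , threshold , inj₂ tᵢ≡0
    where
    |σᵢ|≤Γ = ℕ.≮⇒≥ Γ≮|σᵢ|
    tᵢ≡0 : t i ≡ nothing
    tᵢ≡0 = proj₁ (proj₂ (outline i)) |σᵢ|≤Γ
    top : IsTopSet Γ dev¹ σ i (onMachine σ i)
    top = (λ j → isYes-sound (σ j Fin.≟ i)) , sym (ℕ.m≥n⇒m⊓n≡n |σᵢ|≤Γ) ,
          λ j k _ σk≡i k∉σᵢ → contradiction (trans (sym (isYes-true (σ k Fin.≟ i) σk≡i)) k∉σᵢ) λ ()
    threshold : IsThresholdSet dev¹ σ i (δ ε Γ (t i)) (onMachine σ i)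
    threshold = proj₁ top , (λ j σj≡i _ → isYes-true (σ j Fin.≟ i) σj≡i) ,
                λ j _ dev<δ → contradiction
                  (ℚ.≤-<-trans (dev¹≥0 j) (subst (λ l → dev¹ j < δ ε Γ l) tᵢ≡0 dev<δ)) (ℚ.<-irrefl refl)

  levelLoad-≤-capacity : 0ℚ ≤ ε → (∀ j → 0ℚ ≤ dev¹ j) → ∀ {t} → IsOutline ε Γ dev¹ σ t →
    CΓ≤ Γ nom dev¹ σ 1ℚ → ∀ i → levelLoad ε Γ nom dev¹ σ i (t i) ≤ capacity ε Γ (t i)
  levelLoad-≤-capacity 0≤ε dev¹≥0 {t} outline σ-fits i
    with T , top , threshold , full ← outline⇒thresholdSet dev¹≥0 outline i = begin
    levelLoad ε Γ nom dev¹ σ i (t i)          ≡⟨ levelLoad-threshold {l = t i} threshold ⟩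
    load nom dev¹ σ i T - δᵢ * ℕtoℚ (count T) ≡⟨ cong (λ x → load nom dev¹ σ i T - x) (δ*count≡Γ*δ full) ⟩
    load nom dev¹ σ i T - ℕtoℚ Γ * δᵢ         ≤⟨ ℚ.+-monoˡ-≤ _ (σ-fits i T top) ⟩
    1ℚ - ℕtoℚ Γ * δᵢ                          ≤⟨ p≤p+q 0≤ε ⟩
    capacity ε Γ (t i)                        ∎
    where
    open ℚ.≤-Reasoning
    δᵢ = δ ε Γ (t i)
    δ*count≡Γ*δ : count T ≡ Γ ⊎ t i ≡ nothing → δᵢ * ℕtoℚ (count T) ≡ ℕtoℚ Γ * δᵢ
    δ*count≡Γ*δ (inj₁ |T|≡Γ) = trans (cong (λ c → δᵢ * ℕtoℚ c) |T|≡Γ) (ℚ.*-comm δᵢ (ℕtoℚ Γ))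
    δ*count≡Γ*δ (inj₂ tᵢ≡0) rewrite tᵢ≡0 = trans (ℚ.*-zeroˡ (ℕtoℚ (count T))) (sym (ℚ.*-zeroʳ (ℕtoℚ Γ)))

module _ {m̄ : ΔIdx → ℕ} where

  sameMachine-refl : ∀ (μ : Machine2 m̄) → sameMachine μ μ ≡ true
  sameMachine-refl (mach l k b) =
    cong₂ _∧_ (isYes-true (l ≟Δ l) refl)
              (cong₂ _∧_ (isYes-true (toℕ k ℕ.≟ toℕ k) refl) (isYes-true (b Bool.≟ b) refl))

  sameMachine⇒≡ : ∀ {μ ν : Machine2 m̄} → sameMachine μ ν ≡ true → μ ≡ ν
  sameMachine⇒≡ {mach l k b} {mach l′ k′ b′} e
    with l ≟Δ l′ | toℕ k ℕ.≟ toℕ k′ | b Bool.≟ b′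
  ... | yes refl | yes k≡k′ | yes refl = cong (λ k → mach l k b) (Fin.toℕ-injective k≡k′)

  sameMachine-≢ : ∀ {μ ν : Machine2 m̄} → μ ≢ ν → sameMachine μ ν ≡ false
  sameMachine-≢ μ≢ν = Bool.¬-not (μ≢ν ∘ sameMachine⇒≡)

  _≟M_ : DecidableEquality (Machine2 m̄)
  μ ≟M ν = map′ sameMachine⇒≡ (λ { refl → sameMachine-refl μ }) (sameMachine μ ν Bool.≟ true)

  sameMachine-injective : ∀ {k} {f : Fin k → Machine2 m̄} → Injective _≡_ _≡_ f →
                          ∀ a b → sameMachine (f a) (f b) ≡ ⌊ a Fin.≟ b ⌋
  sameMachine-injective {f = f} f-inj a b with a Fin.≟ b
  ... | yes refl = sameMachine-refl (f a)
  ... | no a≢b   = sameMachine-≢ (a≢b ∘ f-inj)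

  position : Machine2 m̄ → ℕ
  position (mach l k b) = if b then toℕ k else m̄ l ℕ.+ toℕ k

  atPosition : (l : ΔIdx) (p : ℕ) → p ℕ.< 2 ℕ.* m̄ l → Machine2 m̄
  atPosition l p p<2m̄ = mach l (index′ (p ℕ.<? m̄ l)) ⌊ p ℕ.<? m̄ l ⌋
    where
    index′ : Dec (p ℕ.< m̄ l) → Fin (m̄ l)
    index′ (yes p<m̄) = Fin.fromℕ< p<m̄
    index′ (no p≮m̄)  = Fin.fromℕ< (subst (p ℕ.∸ m̄ l ℕ.<_)
      (trans (ℕ.m+n∸m≡n (m̄ l) (m̄ l ℕ.+ 0)) (ℕ.+-identityʳ (m̄ l)))
      (ℕ.∸-monoˡ-< p<2m̄ (ℕ.≮⇒≥ p≮m̄)))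

  position-atPosition : ∀ l p p<2m̄ → position (atPosition l p p<2m̄) ≡ p
  position-atPosition l p p<2m̄ with p ℕ.<? m̄ l
  ... | yes p<m̄ = Fin.toℕ-fromℕ< p<m̄
  ... | no p≮m̄  = trans (cong (m̄ l ℕ.+_) (Fin.toℕ-fromℕ< _)) (ℕ.m+[n∸m]≡n (ℕ.≮⇒≥ p≮m̄))

  atPosition-injective : ∀ {l l′ p p′ p<2m̄ p′<2m̄} →
                         atPosition l p p<2m̄ ≡ atPosition l′ p′ p′<2m̄ → l ≡ l′ × p ≡ p′
  atPosition-injective {l} {l′} {p} {p′} {p<2m̄} {p′<2m̄} e =
    cong level e ,
    trans (sym (position-atPosition l p p<2m̄)) (trans (cong position e) (position-atPosition l′ p′ p′<2m̄))

  orig-atPosition : ∀ l p p<2m̄ → m̄ l ℕ.≤ p → orig (atPosition l p p<2m̄) ≡ false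
  orig-atPosition l p p<2m̄ m̄≤p = isYes-false (p ℕ.<? m̄ l) (ℕ.≤⇒≯ m̄≤p)

ΔList-unique : ∀ ε → Unique (ΔList ε)
ΔList-unique ε = All.map⁺ (All.universal (λ _ ()) _) ∷ Unique.map⁺ just-injective (Unique.upTo⁺ _)
  where
  just-injective : ∀ {x y : ℕ} → just x ≡ just y → x ≡ y
  just-injective refl = refl

load2 : ∀ {n m} (ε : ℚ) (Γ : ℕ) → .{{NonZero Γ}} → (Fin n → ℚ) → (Fin n → ℚ) →
        (m̄ : ΔIdx → ℕ) → (Job2 n m ε m̄ → Machine2 m̄) → Machine2 m̄ → ℚ
load2 ε Γ nom dev¹ m̄ σ² μ =
  sumFin (λ j → if sameMachine (σ² (inj₁ j)) μ then pReg ε Γ (nom j) (dev¹ j) (level μ) else 0ℚ)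
  + sumFin (λ d → if sameMachine (σ² (inj₂ d)) μ then capacity ε Γ (level μ) else 0ℚ)

module Assignment (ε : ℚ) {m : ℕ} (t : Fin m → ΔIdx) (m̄ : ΔIdx → ℕ)
                  (restricted : IsRestrictedOutline m t m̄) where

  open Fibres _≟Δ_ t

  m̄≤size : ∀ l → m̄ l ℕ.≤ size l
  m̄≤size l with proj₂ (restricted l)
  ... | inj₁ (_ , m̄≡0)  = ℕ.≤-trans (ℕ.≤-reflexive m̄≡0) z≤n
  ... | inj₂ (m̄≤size , _) = m̄≤size

  size≤2m̄ : ∀ l → size l ℕ.≤ 2 ℕ.* m̄ l
  size≤2m̄ l with proj₂ (restricted l)
  ... | inj₁ (size≡0 , _)   = ℕ.≤-trans (ℕ.≤-reflexive size≡0) z≤n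
  ... | inj₂ (_ , size<2m̄) = ℕ.<⇒≤ size<2m̄

  level-occupied : ∀ (μ : Machine2 m̄) → ∃[ i ] t i ≡ level μ
  level-occupied μ =
    size-inhabited (ℕ.<-≤-trans (ℕ.≤-<-trans z≤n (Fin.toℕ<n (index μ))) (m̄≤size (level μ)))

  regularMachine : Fin m → Machine2 m̄
  regularMachine i = atPosition (t i) (rank i) (ℕ.<-≤-trans (rank<size i) (size≤2m̄ (t i)))

  regularMachine-injective : Injective _≡_ _≡_ regularMachine
  regularMachine-injective e = let ti≡ti′ , ri≡ri′ = atPosition-injective e in rank-injective ti≡ti′ ri≡ri′

  free : ΔIdx → ℕ
  free l = 2 ℕ.* m̄ l ℕ.∸ size l

  size+k<2m̄ : ∀ l k → k ℕ.< free l → size l ℕ.+ k ℕ.< 2 ℕ.* m̄ l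
  size+k<2m̄ l k k<free =
    subst (ℕ._≤ 2 ℕ.* m̄ l) (cong suc (ℕ.+-comm k (size l))) (ℕ.m≤o∸n⇒m+n≤o (suc k) (size≤2m̄ l) k<free)

  freeMachine : (l : ΔIdx) (k : ℕ) → k ℕ.< free l → Machine2 m̄
  freeMachine l k k<free = atPosition l (size l ℕ.+ k) (size+k<2m̄ l k k<free)

  freeMachine-injective : ∀ {l l′ k k′ k<free k′<free} →
    freeMachine l k k<free ≡ freeMachine l′ k′ k′<free → (l , k) ≡ (l′ , k′)
  freeMachine-injective e with refl , size+k≡size+k′ ← atPosition-injective e =
    cong (_ ,_) (ℕ.+-cancelˡ-≡ _ _ _ size+k≡size+k′)

  freeMachine-clone : ∀ l k k<free → orig (freeMachine l k k<free) ≡ false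
  freeMachine-clone l k k<free =
    orig-atPosition {m̄} l (size l ℕ.+ k) (size+k<2m̄ l k k<free) (ℕ.≤-trans (m̄≤size l) (ℕ.m≤m+n (size l) k))

  regular≢free : ∀ i l k k<free → regularMachine i ≢ freeMachine l k k<free
  regular≢free i l k k<free e with refl , rank≡size+k ← atPosition-injective e =
    ℕ.<⇒≱ (rank<size i) (ℕ.≤-trans (ℕ.m≤m+n (size l) k) (ℕ.≤-reflexive (sym rank≡size+k)))

  Dummy : Set
  Dummy = Fin (2 ℕ.* m′ ε m̄ ℕ.∸ m)

  dummies≤free : 2 ℕ.* m′ ε m̄ ℕ.∸ m ℕ.≤ sumList (map free (ΔList ε))
  dummies≤free = ℕ.m≤n+o⇒m∸n≤o (2 ℕ.* m′ ε m̄) m (begin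
    2 ℕ.* m′ ε m̄                    ≡⟨ sumList-map-* 2 m̄ (ΔList ε) ⟨
    total (λ l → 2 ℕ.* m̄ l)          ≤⟨ sumList-map-≤ {g = size} {h = free}
                                           (λ l → ℕ.m≤n+m∸n (2 ℕ.* m̄ l) (size l)) (ΔList ε) ⟩
    total size ℕ.+ total free       ≤⟨ ℕ.+-monoˡ-≤ (total free) (sumList-size-≤ (ΔList-unique ε)) ⟩
    m ℕ.+ total free                ∎)
    where
    open ℕ.≤-Reasoning
    total : (ΔIdx → ℕ) → ℕ
    total f = sumList (map f (ΔList ε))

  slot : Dummy → ΔIdx × ℕ
  slot d = pick free (ΔList ε) (Fin.inject≤ d dummies≤free)

  dummyMachine : Dummy → Machine2 m̄
  dummyMachine d = freeMachine (proj₁ (slot d)) (proj₂ (slot d)) (pick-< free (ΔList ε) _)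

  regular≢dummy : ∀ i d → regularMachine i ≢ dummyMachine d
  regular≢dummy i d = regular≢free i (proj₁ (slot d)) (proj₂ (slot d)) (pick-< free (ΔList ε) _)

  dummyMachine-injective : Injective _≡_ _≡_ dummyMachine
  dummyMachine-injective {d} {d′} e = Fin.inject≤-injective _ _ d d′
    (pick-injective free (ΔList-unique ε) (freeMachine-injective e))

  schedule2 : ∀ {n} → Schedule n m → Job2 n m ε m̄ → Machine2 m̄
  schedule2 σ (inj₁ j) = regularMachine (σ j)
  schedule2 σ (inj₂ d) = dummyMachine d

  dummies-on-clones : ∀ {n} (σ : Schedule n m) d → orig (schedule2 σ (inj₂ d)) ≡ false
  dummies-on-clones σ d = freeMachine-clone (proj₁ (slot d)) (proj₂ (slot d)) (pick-< free (ΔList ε) _)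

  module _ {n Γ} .{{_ : NonZero Γ}} {nom dev¹ : Fin n → ℚ} (σ : Schedule n m) where

    load² : Machine2 m̄ → ℚ
    load² = load2 {m = m} ε Γ nom dev¹ m̄ (schedule2 σ)

    load²-regularMachine : ∀ i → load² (regularMachine i) ≡ levelLoad ε Γ nom dev¹ σ i (t i)
    load²-regularMachine i = begin
      load² (regularMachine i)              ≡⟨ cong₂ _+_ (sumFin-cong jobs-of-i) (sumFin-zero no-dummy) ⟩
      levelLoad ε Γ nom dev¹ σ i (t i) + 0ℚ ≡⟨ ℚ.+-identityʳ _ ⟩
      levelLoad ε Γ nom dev¹ σ i (t i)      ∎
      where
      open ≡-Reasoning
      p : Fin n → ℚ
      p j = pReg ε Γ (nom j) (dev¹ j) (t i)
      jobs-of-i : ∀ j → (if sameMachine (regularMachine (σ j)) (regularMachine i) then p j else 0ℚ)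
                        ≡ (if onMachine σ i j then p j else 0ℚ)
      jobs-of-i j = cong (λ b → if b then p j else 0ℚ)
                         (sameMachine-injective regularMachine-injective (σ j) i)
      no-dummy : ∀ d → (if sameMachine (dummyMachine d) (regularMachine i) then capacity ε Γ (t i) else 0ℚ)
                       ≡ 0ℚ
      no-dummy d = cong (λ b → if b then capacity ε Γ (t i) else 0ℚ)
                        (sameMachine-≢ (λ e → regular≢dummy i d (sym e)))

    load²-irregular-≤ : ∀ μ → (∀ i → regularMachine i ≢ μ) → 0ℚ ≤ capacity ε Γ (level μ) →
                        load² μ ≤ capacity ε Γ (level μ)
    load²-irregular-≤ μ irregular 0≤capacity = begin
      load² μ                 ≡⟨ cong (_+ dummyLoad) (sumFin-zero no-job) ⟩
      0ℚ + dummyLoad          ≡⟨ ℚ.+-identityˡ dummyLoad ⟩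
      dummyLoad               ≤⟨ sumFin-atMostOne-≤ _ 0≤capacity one-dummy ⟩
      capacity ε Γ (level μ)  ∎
      where
      open ℚ.≤-Reasoning
      dummyLoad : ℚ
      dummyLoad = sumFin (λ d → if sameMachine (dummyMachine d) μ then capacity ε Γ (level μ) else 0ℚ)
      no-job : ∀ j → (if sameMachine (regularMachine (σ j)) μ then pReg ε Γ (nom j) (dev¹ j) (level μ) else 0ℚ)
                     ≡ 0ℚ
      no-job j = cong (λ b → if b then pReg ε Γ (nom j) (dev¹ j) (level μ) else 0ℚ)
                      (sameMachine-≢ (irregular (σ j)))
      one-dummy : ∀ d d′ → sameMachine (dummyMachine d) μ ≡ true → sameMachine (dummyMachine d′) μ ≡ true →
                  d ≡ d′
      one-dummy d d′ e e′ = dummyMachine-injective (trans (sameMachine⇒≡ e) (sym (sameMachine⇒≡ e′)))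

    schedule2-fits : (∀ i → levelLoad ε Γ nom dev¹ σ i (t i) ≤ capacity ε Γ (t i)) →
                     (∀ i → 0ℚ ≤ capacity ε Γ (t i)) →
                     ∀ μ → load² μ ≤ capacity ε Γ (level μ)
    schedule2-fits levels-fit capacities-nonNeg μ = fits (Fin.any? (λ i → regularMachine i ≟M μ))
      where
      Fits : Machine2 m̄ → Set
      Fits ν = load² ν ≤ capacity ε Γ (level ν)
      fits : Dec (∃[ i ] regularMachine i ≡ μ) → Fits μ
      fits (yes (i , e))  =
        subst Fits e (ℚ.≤-trans (ℚ.≤-reflexive (load²-regularMachine i)) (levels-fit i))
      fits (no irregular) = load²-irregular-≤ μ (λ i e → irregular (i , e))
        (subst (λ l → 0ℚ ≤ capacity ε Γ l) (proj₂ occupant) (capacities-nonNeg (proj₁ occupant)))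
        where occupant = level-occupied μ

lemma6 : (n m Γ : ℕ) → .{{_ : NonZero Γ}} → (ε : ℚ) → 0ℚ < ε →
         (nom dev dev¹ : Fin n → ℚ) →
         (∀ j → 0ℚ ≤ nom j) → (∀ j → 0ℚ ≤ dev j) →
         (∀ j → IsRounding ε Γ (dev j) (dev¹ j)) →
         (σ : Schedule n m) → IsOptimal Γ nom dev¹ σ →
         CΓ≤ Γ nom dev¹ σ 1ℚ →
         (t : Fin m → ΔIdx) → IsOutline ε Γ dev¹ σ t →
         (m̄ : ΔIdx → ℕ) → IsRestrictedOutline m t m̄ →
         ∃[ σ² ] IsFeasible2 {n} {m} ε Γ nom dev¹ m̄ σ²
lemma6 n m Γ ε 0<ε nom dev dev¹ _ _ rounded σ _ σ-fits t outline m̄ restricted =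
  schedule2 σ , dummies-on-clones σ ,
  schedule2-fits σ (levelLoad-≤-capacity ε nom dev¹ σ 0≤ε dev¹≥0 outline σ-fits)
                 (λ i → capacity-nonNeg 0≤ε (proj₁ (outline i)))
  where
  open Assignment ε t m̄ restricted
  0≤ε : 0ℚ ≤ ε
  0≤ε = ℚ.<⇒≤ 0<ε
  dev¹≥0 : ∀ j → 0ℚ ≤ dev¹ j
  dev¹≥0 j = rounding-nonNeg 0≤ε (rounded j)
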